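{- Let $k\ge1$ and $l\ge1$ be integers, let $\mu'=(\mu'_1,\ldots,\mu'_k)$ be a partition with $\mu'_k\ge 2$, and let $\mu=(\mu'_1,\ldots,\mu'_k,2^l)$ be the partition obtained by appending $l$ parts equal to $2$. For a filling $T$ of shape $\mu$, let $T'$ be the filling of shape $\mu'$ with $T'_{i,j}=T_{i,j}$ for $(i,j)\in\mu'$, let $T''$ be the filling of shape $(2^l)$ with $T''_{i,j}=T_{k+i,j}$ for $1\le i\le l$, $1\le j\le 2$, and let $\tau(T)$ be the filling of shape $\mu$ produced by the procedure described below. Then for every filling $T$ of shape $\mu$, \[ \operatorname{maj}(\tau(T))\equiv \operatorname{maj}(T')+\operatorname{maj}(T'')\pmod{l} \quad\text{and}\quad \operatorname{inv}(\tau(T))=\operatorname{inv}(T')+\operatorname{inv}(T''). \]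
   Context: Diagrams are in French convention: the diagram of a partition $\lambda=(\lambda_1\ge\cdots\ge\lambda_r>0)$ is the set of cells $(i,j)$ with $1\le i\le r$, $1\le j\le\lambda_i$ (row $i$ counted from the bottom, column $j$ from the left). For a cell $u=(i,j)$, $\operatorname{arm}(u)=\lambda_i-j$ is the number of cells strictly to its right and $\operatorname{leg}(u)$ is the number of cells of the diagram strictly above it in column $j$. A filling $T$ of shape $\lambda$ assigns a positive integer $T_{i,j}$ to each cell, with no monotonicity condition. A descent of $T$ is a cell $(i,j)$ with $i\ge 2$ and $T_{i,j}>T_{i-1,j}$; $\operatorname{Des}(T)$ is the set of descents and $\operatorname{maj}(T)=\sum_{u\in\operatorname{Des}(T)}(\operatorname{leg}(u)+1)$. Two distinct cells attack each other if they lie in the same row, or if they are of the form $(i,k)$ and $(i-1,j)$ with $j<k$. The reading order reads rows from top to bottom and each row from left to right. A pair $(u,v)$ of cells is an inversion if $u,v$ attack each other, $T_u<T_v$, and $v$ precedes $u$ in the reading order; $\operatorname{Inv}(T)$ is the number of inversions and $\operatorname{inv}(T)=\operatorname{Inv}(T)-\sum_{u\in\operatorname{Des}(T)}\operatorname{arm}(u)$. Statistics are computed with respect to the shape of the filling in question. Conditions: given numbers $a,b,A$, the triple satisfies condition $xAx$ if $a\le A<b$ or $b\le A<a$. Given numbers $a,b,A,B$, the quadruple satisfies condition $xXxX$ if one of the following holds: $a\le A<b\le B$; $A<b\le B<a$; $b\le A<a\le B$; $A<a\le B<b$; $a\le B<b\le A$; $B<b\le A<a$; $b\le B<a\le A$;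 $B<a\le A<b$. For a filling $S$ and a row index $i$ with row $i+1$ of length $2$, "rows $i$ and $i+1$ of $S$ satisfy $xAx$" means $(a,b,A)=(S_{i+1,1},S_{i+1,2},S_{i,1})$ satisfies $xAx$; when rows $i$ and $i+1$ both have length $2$, "rows $i$ and $i+1$ satisfy $xXxX$" means $(a,b,A,B)=(S_{i+1,1},S_{i+1,2},S_{i,1},S_{i,2})$ satisfies $xXxX$. Definition of $\tau(T)$: set $S\leftarrow T$ and $i\leftarrow k$. If rows $k$ and $k+1$ of $S$ do not satisfy $xAx$, return $S$. Otherwise swap the two entries of row $k+1$ of $S$ and set $i\leftarrow k+1$. Then, while $i+1\le k+l$ and rows $i$ and $i+1$ of the current $S$ satisfy $xXxX$, swap the two entries of row $i+1$ of $S$ and set $i\leftarrow i+1$. Return $S$; this is $\tau(T)$. -}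

module Defs where

open import Data.Nat using (ℕ; zero; suc; _+_; _∸_; _≤_; _<_; _≤ᵇ_; _<ᵇ_; _≡ᵇ_)
open import Data.Bool using (Bool; true; false; _∧_; _∨_; not; if_then_else_)
open import Data.List using (List; []; _∷_; length; map; upTo; concatMap; filterᵇ)
open import Data.Nat.ListAction using (sum)
open import Data.Product using (_×_; _,_; proj₁; proj₂)
open import Data.Integer using (ℤ; +_; _-_)

-- A partition is a list of row lengths, bottom row first (French convention).
-- Rows and columns are 1-indexed.

data IsPartition : List ℕ → Set where
  nil  : IsPartition []
  one  : ∀ {x} → 1 ≤ x → IsPartition (x ∷ [])
  cons : ∀ {x y ys} → y ≤ x → IsPartition (y ∷ ys) → IsPartition (x ∷ y ∷ ys)

rowLen : List ℕ → ℕ → ℕ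
rowLen [] _ = 0
rowLen (x ∷ xs) zero = 0
rowLen (x ∷ xs) (suc zero) = x
rowLen (x ∷ xs) (suc (suc i)) = rowLen xs (suc i)

range : ℕ → List ℕ
range n = map suc (upTo n)

Cell : Set
Cell = ℕ × ℕ

cells : List ℕ → List Cell
cells λs = concatMap (λ i → map (λ j → (i , j)) (range (rowLen λs i))) (range (length λs))

-- A filling assigns a value T i j to cell (i , j); values outside the shape are irrelevant.
Filling : Set
Filling = ℕ → ℕ → ℕ

IsFilling : List ℕ → Filling → Set
IsFilling λs T = ∀ i j → 1 ≤ i → i ≤ length λs → 1 ≤ j → j ≤ rowLen λs i → 1 ≤ T i j

count : {A : Set} → (A → Bool) → List A → ℕ
count p xs = length (filterᵇ p xs)

arm : List ℕ → Cell → ℕ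
arm λs (i , j) = rowLen λs i ∸ j

leg : List ℕ → Cell → ℕ
leg λs (i , j) = count (λ i' → (i <ᵇ i') ∧ (j ≤ᵇ rowLen λs i')) (range (length λs))

isDescent : Filling → Cell → Bool
isDescent T (i , j) = (2 ≤ᵇ i) ∧ (T (i ∸ 1) j <ᵇ T i j)

descents : List ℕ → Filling → List Cell
descents λs T = filterᵇ (isDescent T) (cells λs)

maj : List ℕ → Filling → ℕ
maj λs T = sum (map (λ u → leg λs u + 1) (descents λs T))

cellEq : Cell → Cell → Bool
cellEq (i , j) (i' , j') = (i ≡ᵇ i') ∧ (j ≡ᵇ j')

attacks : Cell → Cell → Bool
attacks (i , k) (i' , j) =
  not (cellEq (i , k) (i' , j)) ∧
  ((i ≡ᵇ i') ∨ ((i ≡ᵇ suc i') ∧ (j <ᵇ k)) ∨ ((i' ≡ᵇ suc i) ∧ (k <ᵇ j)))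

-- v precedes u in the reading order (rows top to bottom, each row left to right)
precedes : Cell → Cell → Bool
precedes (iv , jv) (iu , ju) = (iu <ᵇ iv) ∨ ((iv ≡ᵇ iu) ∧ (jv <ᵇ ju))

isInversion : Filling → Cell × Cell → Bool
isInversion T ((iu , ju) , (iv , jv)) =
  attacks (iu , ju) (iv , jv) ∧ (T iu ju <ᵇ T iv jv) ∧ precedes (iv , jv) (iu , ju)

pairs : List Cell → List (Cell × Cell)
pairs cs = concatMap (λ u → map (λ v → (u , v)) cs) cs

Inv : List ℕ → Filling → ℕ
Inv λs T = count (isInversion T) (pairs (cells λs))

inv : List ℕ → Filling → ℤ
inv λs T = + Inv λs T - + sum (map (arm λs) (descents λs T))

xAx : ℕ → ℕ → ℕ → Bool
xAx a b A = ((a ≤ᵇ A) ∧ (A <ᵇ b)) ∨ ((b ≤ᵇ A) ∧ (A <ᵇ a))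

xXxX : ℕ → ℕ → ℕ → ℕ → Bool
xXxX a b A B =
  ((a ≤ᵇ A) ∧ (A <ᵇ b) ∧ (b ≤ᵇ B)) ∨
  ((A <ᵇ b) ∧ (b ≤ᵇ B) ∧ (B <ᵇ a)) ∨
  ((b ≤ᵇ A) ∧ (A <ᵇ a) ∧ (a ≤ᵇ B)) ∨
  ((A <ᵇ a) ∧ (a ≤ᵇ B) ∧ (B <ᵇ b)) ∨
  ((a ≤ᵇ B) ∧ (B <ᵇ b) ∧ (b ≤ᵇ A)) ∨
  ((B <ᵇ b) ∧ (b ≤ᵇ A) ∧ (A <ᵇ a)) ∨
  ((b ≤ᵇ B) ∧ (B <ᵇ a) ∧ (a ≤ᵇ A)) ∨
  ((B <ᵇ a) ∧ (a ≤ᵇ A) ∧ (A <ᵇ b))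

swapRow : Filling → ℕ → Filling
swapRow S r i j with i ≡ᵇ r
... | false = S i j
... | true with j
...   | 1 = S i 2
...   | 2 = S i 1
...   | _ = S i j

rowsXXXX : Filling → ℕ → Bool
rowsXXXX S i = xXxX (S (suc i) 1) (S (suc i) 2) (S i 1) (S i 2)

-- the while loop; n = number of remaining admissible steps (k + l - i)
tauLoop : ℕ → Filling → ℕ → Filling
tauLoop zero S i = S
tauLoop (suc n) S i =
  if rowsXXXX S i then tauLoop n (swapRow S (suc i)) (suc i) else S

tau : ℕ → ℕ → Filling → Filling
tau k l T =
  if xAx (T (suc k) 1) (T (suc k) 2) (T k 1)
  then tauLoop (l ∸ 1) (swapRow T (suc k)) (suc k)
  else T

upperPart : ℕ → Filling → Filling
upperPart k T i j = T (k + i) j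

module Submission where

-- Let k = length μ' and glue the rectangle 2^l on top of μ'. For a filling S of the glued shape, a descent
-- of μ' in column 1 or 2 gains l in leg and a descent in row k + 1 has leg + 1 = l, so
-- maj S ≡ maj S' + maj S'' (mod l). The only attacking pair across the seam is ((k,1),(k+1,2)) and the
-- seam descent at (k+1,1) has arm 1, so inv S = inv S' + inv S'' + w(S_{k,1}), where
-- w(c) = [c < S_{k+1,2}] - [c < S_{k+1,1}] is the window of row k + 1. The window of a row (a,b) at c is
-- sgn(a,b) if c separates a from b and 0 otherwise: xAx says that T_{k,1} separates the row above it,
-- xXxX that exactly one entry of a row separates the row above.
-- τ fixes rows 1..k, and on the rectangle it swaps the first row and then cascades upwards. By induction
-- on the height the cascade preserves maj and adds sgn(a,b) to inv, (a,b) being the first row: if the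
-- loop stops, the windows of the second row at the two entries of the first agree, so the swap is
-- invisible to the second row; if it goes on, xXxX makes the sum of these windows equal to the sgn that
-- the cascade above adds. Under xAx the seam term becomes -w(T_{k,1}) = -sgn(a,b) and cancels it;
-- otherwise τ(T) = T and w(T_{k,1}) = 0.

open import Defs

module FillingStatistics where

  open import Data.Bool using (Bool; true; false; not; _∧_; _xor_; if_then_else_; T)
  open import Data.Bool.Properties using (∧-zeroʳ; ∧-identityʳ; ∧-assoc)
  open import Data.Empty using (⊥; ⊥-elim)
  import Data.Integer.Properties as ℤ
  import Data.Integer.Tactic.RingSolver as ℤ-Ring
  open import Data.List using (List; []; _∷_; length; map; upTo; concat; concatMap; filterᵇ; _++_; replicate; [_])
  open import Data.List.Properties
    using (map-++; map-∘; map-id; map-cong-local; map-upTo; upTo-∷ʳ; length-map; length-upTo; length-++;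
           length-replicate; concatMap-++; concatMap-map; map-concatMap)
  open import Data.List.Relation.Unary.All as All using (All; []; _∷_)
  import Data.List.Relation.Unary.All.Properties as All
  open import Data.Nat
  open import Data.Nat.ListAction using (sum)
  open import Data.Nat.ListAction.Properties using (sum-++)
  open import Data.Nat.Properties
  open import Algebra.Properties.CommutativeSemigroup +-commutativeSemigroup using (interchange; xy∙z≈xz∙y)
  open import Data.Nat.Tactic.RingSolver using (solve-∀)
  open import Data.Product using (_×_; _,_; proj₂)
  open import Data.Unit using (tt)
  open import Function using (_∘_)
  open import Relation.Binary.PropositionalEquality hiding ([_])
  open import Relation.Nullary using (Dec; yes; no)
  open ≡-Reasoning

  𝟙 : Bool → ℕ
  𝟙 b = if b then 1 else 0

  <⇒<ᵇ≡true : ∀ {m n} → m < n → (m <ᵇ n) ≡ true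
  <⇒<ᵇ≡true {m} {n} m<n with m <ᵇ n in eq
  ... | true = refl
  ... | false = ⊥-elim (subst T eq (<⇒<ᵇ m<n))

  ≥⇒<ᵇ≡false : ∀ {m n} → n ≤ m → (m <ᵇ n) ≡ false
  ≥⇒<ᵇ≡false {m} {n} n≤m with m <ᵇ n in eq
  ... | true = ⊥-elim (≤⇒≯ n≤m (<ᵇ⇒< m n (subst T (sym eq) tt)))
  ... | false = refl

  <ᵇ≡true⇒< : ∀ m n → (m <ᵇ n) ≡ true → m < n
  <ᵇ≡true⇒< m n eq = <ᵇ⇒< m n (subst T (sym eq) tt)

  <ᵇ≡false⇒≥ : ∀ m n → (m <ᵇ n) ≡ false → n ≤ m
  <ᵇ≡false⇒≥ m n eq = ≮⇒≥ λ m<n → subst T eq (<⇒<ᵇ m<n)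

  ≤⇒≤ᵇ≡true : ∀ {m n} → m ≤ n → (m ≤ᵇ n) ≡ true
  ≤⇒≤ᵇ≡true {m} {n} m≤n with m ≤ᵇ n in eq
  ... | true = refl
  ... | false = ⊥-elim (subst T eq (≤⇒≤ᵇ m≤n))

  ≡ᵇ-refl : ∀ m → (m ≡ᵇ m) ≡ true
  ≡ᵇ-refl zero = refl
  ≡ᵇ-refl (suc m) = ≡ᵇ-refl m

  ≢⇒≡ᵇ≡false : ∀ {m n} → m ≢ n → (m ≡ᵇ n) ≡ false
  ≢⇒≡ᵇ≡false {m} {n} m≢n with m ≡ᵇ n in eq
  ... | true = ⊥-elim (m≢n (≡ᵇ⇒≡ m n (subst T (sym eq) tt)))
  ... | false = refl

  <ᵇ-suc : ∀ m n → (m <ᵇ suc n) ≡ (m ≤ᵇ n)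
  <ᵇ-suc zero n = refl
  <ᵇ-suc (suc m) n = refl

  ≤ᵇ≡not<ᵇ : ∀ m n → (m ≤ᵇ n) ≡ not (n <ᵇ m)
  ≤ᵇ≡not<ᵇ zero n = refl
  ≤ᵇ≡not<ᵇ (suc m) zero = refl
  ≤ᵇ≡not<ᵇ (suc m) (suc n) = trans (<ᵇ-suc m n) (≤ᵇ≡not<ᵇ m n)

  +-≡ᵇ : ∀ k m n → (k + m ≡ᵇ k + n) ≡ (m ≡ᵇ n)
  +-≡ᵇ zero m n = refl
  +-≡ᵇ (suc k) m n = +-≡ᵇ k m n

  +-<ᵇ : ∀ k m n → (k + m <ᵇ k + n) ≡ (m <ᵇ n)
  +-<ᵇ zero m n = refl
  +-<ᵇ (suc k) m n = +-<ᵇ k m n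

  ∑ : {A : Set} → List A → (A → ℕ) → ℕ
  ∑ xs f = sum (map f xs)

  module _ {A : Set} where

    ∑-++ : ∀ (xs ys : List A) f → ∑ (xs ++ ys) f ≡ ∑ xs f + ∑ ys f
    ∑-++ xs ys f = trans (cong sum (map-++ f xs ys)) (sum-++ (map f xs) (map f ys))

    ∑-map : {C : Set} (g : C → A) (xs : List C) (f : A → ℕ) → ∑ (map g xs) f ≡ ∑ xs (f ∘ g)
    ∑-map g xs f = cong sum (sym (map-∘ xs))

    ∑-concatMap : {C : Set} (g : C → List A) (xs : List C) (f : A → ℕ) →
      ∑ (concatMap g xs) f ≡ ∑ xs (λ x → ∑ (g x) f)
    ∑-concatMap g [] f = refl
    ∑-concatMap g (x ∷ xs) f = trans (∑-++ (g x) (concatMap g xs) f) (cong (∑ (g x) f +_) (∑-concatMap g xs f))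

    ∑-filterᵇ : (p : A → Bool) (xs : List A) (f : A → ℕ) →
      ∑ (filterᵇ p xs) f ≡ ∑ xs (λ x → if p x then f x else 0)
    ∑-filterᵇ p [] f = refl
    ∑-filterᵇ p (x ∷ xs) f with p x
    ... | true = cong (f x +_) (∑-filterᵇ p xs f)
    ... | false = ∑-filterᵇ p xs f

    count≡∑ : (p : A → Bool) (xs : List A) → count p xs ≡ ∑ xs (𝟙 ∘ p)
    count≡∑ p [] = refl
    count≡∑ p (x ∷ xs) with p x
    ... | true = cong suc (count≡∑ p xs)
    ... | false = count≡∑ p xs

    ∑-cong : {f g : A → ℕ} → (∀ x → f x ≡ g x) → (xs : List A) → ∑ xs f ≡ ∑ xs g
    ∑-cong f≗g [] = refl
    ∑-cong f≗g (x ∷ xs) = cong₂ _+_ (f≗g x) (∑-cong f≗g xs)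

    ∑-cong-All : {P : A → Set} {f g : A → ℕ} {xs : List A} →
      All P xs → (∀ {x} → P x → f x ≡ g x) → ∑ xs f ≡ ∑ xs g
    ∑-cong-All ps f≗g = cong sum (map-cong-local (All.map f≗g ps))

    ∑-+ : (xs : List A) (f g : A → ℕ) → ∑ xs (λ x → f x + g x) ≡ ∑ xs f + ∑ xs g
    ∑-+ [] f g = refl
    ∑-+ (x ∷ xs) f g = trans (cong (f x + g x +_) (∑-+ xs f g)) (interchange (f x) (g x) (∑ xs f) (∑ xs g))

    ∑-*ˡ : (c : ℕ) (xs : List A) (f : A → ℕ) → ∑ xs (λ x → c * f x) ≡ c * ∑ xs f
    ∑-*ˡ c [] f = sym (*-zeroʳ c)
    ∑-*ˡ c (x ∷ xs) f = trans (cong (c * f x +_) (∑-*ˡ c xs f)) (sym (*-distribˡ-+ c (f x) (∑ xs f)))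

    ∑-const : (xs : List A) (c : ℕ) → ∑ xs (λ _ → c) ≡ length xs * c
    ∑-const [] c = refl
    ∑-const (x ∷ xs) c = cong (c +_) (∑-const xs c)

    ∑-zero : {P : A → Set} {f : A → ℕ} {xs : List A} → All P xs → (∀ {x} → P x → f x ≡ 0) → ∑ xs f ≡ 0
    ∑-zero {xs = xs} ps f≡0 = trans (∑-cong-All ps f≡0) (trans (∑-const xs 0) (*-zeroʳ (length xs)))

  range-suc : ∀ n → range (suc n) ≡ 1 ∷ map suc (range n)
  range-suc n = cong (λ xs → 1 ∷ map suc xs) (sym (map-upTo suc n))

  range-+ : ∀ k l → range (k + l) ≡ range k ++ map (k +_) (range l)
  range-+ zero l = sym (map-id (range l))
  range-+ (suc k) l = begin
    range (suc (k + l))                                     ≡⟨ range-suc (k + l) ⟩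
    1 ∷ map suc (range (k + l))                             ≡⟨ cong (λ xs → 1 ∷ map suc xs) (range-+ k l) ⟩
    1 ∷ map suc (range k ++ map (k +_) (range l))           ≡⟨ cong (1 ∷_) (map-++ suc (range k) _) ⟩
    1 ∷ (map suc (range k) ++ map suc (map (k +_) (range l))) ≡⟨ cong (λ xs → 1 ∷ (map suc (range k) ++ xs)) (sym (map-∘ (range l))) ⟩
    (1 ∷ map suc (range k)) ++ map (suc k +_) (range l)     ≡⟨ cong (_++ map (suc k +_) (range l)) (sym (range-suc k)) ⟩
    range (suc k) ++ map (suc k +_) (range l)               ∎

  range-∷ʳ : ∀ n → range (suc n) ≡ range n ++ [ suc n ]
  range-∷ʳ n = trans (cong (map suc) (sym (upTo-∷ʳ n))) (map-++ suc (upTo n) [ n ])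

  length-range : ∀ n → length (range n) ≡ n
  length-range n = trans (length-map suc (upTo n)) (length-upTo n)

  All-range : ∀ n → All (λ i → 1 ≤ i × i ≤ n) (range n)
  All-range zero = []
  All-range (suc n) rewrite range-suc n =
    (s≤s z≤n , s≤s z≤n) ∷ All.map⁺ (All.map (λ (_ , i≤n) → s≤s z≤n , s≤s i≤n) (All-range n))

  shift : ℕ → Cell → Cell
  shift k (i , j) = k + i , j

  row : List ℕ → ℕ → List Cell
  row λs i = map (i ,_) (range (rowLen λs i))

  InShape : List ℕ → Cell → Set
  InShape λs (i , j) = (1 ≤ i × i ≤ length λs) × (1 ≤ j × j ≤ rowLen λs i)

  All-cells : ∀ λs → All (InShape λs) (cells λs)
  All-cells λs = All.concat⁺ (All.map⁺ (All.map in-row (All-range (length λs))))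
    where
    in-row : ∀ {i} → 1 ≤ i × i ≤ length λs → All (InShape λs) (row λs i)
    in-row i∈ = All.map⁺ (All.map (i∈ ,_) (All-range (rowLen λs _)))

  rowLen-zero : ∀ λs → rowLen λs 0 ≡ 0
  rowLen-zero [] = refl
  rowLen-zero (x ∷ λs) = refl

  rowLen-++ˡ : ∀ μ ν {i} → i ≤ length μ → rowLen (μ ++ ν) i ≡ rowLen μ i
  rowLen-++ˡ [] ν {zero} _ = rowLen-zero ν
  rowLen-++ˡ (x ∷ μ) ν {zero} _ = refl
  rowLen-++ˡ (x ∷ μ) ν {suc zero} _ = refl
  rowLen-++ˡ (x ∷ μ) ν {suc (suc i)} (s≤s i<) = rowLen-++ˡ μ ν i<

  rowLen-++ʳ : ∀ μ ν i → rowLen (μ ++ ν) (length μ + suc i) ≡ rowLen ν (suc i)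
  rowLen-++ʳ [] ν i = refl
  rowLen-++ʳ (x ∷ μ) ν i = begin
    rowLen (x ∷ μ ++ ν) (suc (length μ + suc i))   ≡⟨ cong (rowLen (x ∷ μ ++ ν) ∘ suc) (+-suc (length μ) i) ⟩
    rowLen (μ ++ ν) (suc (length μ + i))           ≡⟨ cong (rowLen (μ ++ ν)) (+-suc (length μ) i) ⟨
    rowLen (μ ++ ν) (length μ + suc i)             ≡⟨ rowLen-++ʳ μ ν i ⟩
    rowLen ν (suc i)                               ∎

  rowLen-replicate : ∀ l x {i} → 1 ≤ i → i ≤ l → rowLen (replicate l x) i ≡ x
  rowLen-replicate (suc l) x {suc zero} _ _ = refl
  rowLen-replicate (suc l) x {suc (suc i)} _ (s≤s i<l) = rowLen-replicate l x (s≤s z≤n) i<l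

  cells-++ : ∀ μ ν → cells (μ ++ ν) ≡ cells μ ++ map (shift (length μ)) (cells ν)
  cells-++ μ ν = begin
    concatMap (row (μ ++ ν)) (range (length (μ ++ ν)))                  ≡⟨ cong (concatMap (row (μ ++ ν)) ∘ range) (length-++ μ) ⟩
    concatMap (row (μ ++ ν)) (range (k + m))                            ≡⟨ cong (concatMap (row (μ ++ ν))) (range-+ k m) ⟩
    concatMap (row (μ ++ ν)) (range k ++ map (k +_) (range m))          ≡⟨ concatMap-++ (row (μ ++ ν)) (range k) _ ⟩
    concatMap (row (μ ++ ν)) (range k)
      ++ concatMap (row (μ ++ ν)) (map (k +_) (range m))                ≡⟨ cong₂ _++_ lower upper ⟩
    cells μ ++ map (shift k) (cells ν)                                  ∎
    where
    k = length μ
    m = length ν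
    lower : concatMap (row (μ ++ ν)) (range k) ≡ cells μ
    lower = cong concat (map-cong-local (All.map (λ {i} (_ , i≤k) → cong (map (i ,_) ∘ range) (rowLen-++ˡ μ ν i≤k)) (All-range k)))
    shifted-row : ∀ {i} → 1 ≤ i × i ≤ m → row (μ ++ ν) (k + i) ≡ map (shift k) (row ν i)
    shifted-row {suc i} _ = trans (cong (map (k + suc i ,_) ∘ range) (rowLen-++ʳ μ ν i)) (map-∘ (range (rowLen ν (suc i))))
    upper : concatMap (row (μ ++ ν)) (map (k +_) (range m)) ≡ map (shift k) (cells ν)
    upper = begin
      concatMap (row (μ ++ ν)) (map (k +_) (range m))  ≡⟨ concatMap-map (row (μ ++ ν)) (k +_) (range m) ⟩
      concatMap (row (μ ++ ν) ∘ (k +_)) (range m)      ≡⟨ cong concat (map-cong-local (All.map shifted-row (All-range m))) ⟩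
      concatMap (map (shift k) ∘ row ν) (range m)      ≡⟨ map-concatMap (shift k) (row ν) (range m) ⟨
      map (shift k) (cells ν)                          ∎

  ∑-cells-++ : ∀ μ ν f → ∑ (cells (μ ++ ν)) f ≡ ∑ (cells μ) f + ∑ (cells ν) (f ∘ shift (length μ))
  ∑-cells-++ μ ν f = begin
    ∑ (cells (μ ++ ν)) f                                      ≡⟨ cong (λ cs → ∑ cs f) (cells-++ μ ν) ⟩
    ∑ (cells μ ++ map (shift (length μ)) (cells ν)) f         ≡⟨ ∑-++ (cells μ) _ f ⟩
    ∑ (cells μ) f + ∑ (map (shift (length μ)) (cells ν)) f    ≡⟨ cong (∑ (cells μ) f +_) (∑-map (shift (length μ)) (cells ν) f) ⟩
    ∑ (cells μ) f + ∑ (cells ν) (f ∘ shift (length μ))        ∎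

  ∑-cells-rectangle : ∀ n f → ∑ (cells (replicate (suc n) 2)) f ≡ f (1 , 1) + (f (1 , 2) + ∑ (cells (replicate n 2)) (f ∘ shift 1))
  ∑-cells-rectangle n f = begin
    ∑ (cells ([ 2 ] ++ replicate n 2)) f                      ≡⟨ ∑-cells-++ [ 2 ] (replicate n 2) f ⟩
    f (1 , 1) + (f (1 , 2) + 0) + rest                        ≡⟨ +-assoc (f (1 , 1)) _ rest ⟩
    f (1 , 1) + (f (1 , 2) + 0 + rest)                        ≡⟨ cong (λ x → f (1 , 1) + (x + rest)) (+-identityʳ (f (1 , 2))) ⟩
    f (1 , 1) + (f (1 , 2) + rest)                            ∎
    where rest = ∑ (cells (replicate n 2)) (f ∘ shift 1)

  ∑-range-δ : ∀ n {j} (f : ℕ → ℕ) → 1 ≤ j → j ≤ n → ∑ (range n) (λ x → if x ≡ᵇ j then f x else 0) ≡ f j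
  ∑-range-δ n {suc j} f _ j<n = begin
    ∑ (range n) δ                                                ≡⟨ cong (λ m → ∑ (range m) δ) (sym (m+[n∸m]≡n j<n)) ⟩
    ∑ (range (suc j + m)) δ                                      ≡⟨ cong (λ xs → ∑ xs δ) (range-+ (suc j) m) ⟩
    ∑ (range (suc j) ++ map (suc j +_) (range m)) δ              ≡⟨ ∑-++ (range (suc j)) _ δ ⟩
    ∑ (range (suc j)) δ + ∑ (map (suc j +_) (range m)) δ         ≡⟨ cong₂ _+_ (cong (λ xs → ∑ xs δ) (range-∷ʳ j)) (∑-map (suc j +_) (range m) δ) ⟩
    ∑ (range j ++ [ suc j ]) δ + ∑ (range m) (δ ∘ (suc j +_))    ≡⟨ cong₂ _+_ (∑-++ (range j) [ suc j ] δ) (∑-zero (All-range m) above) ⟩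
    ∑ (range j) δ + (δ (suc j) + 0) + 0                          ≡⟨ cong (λ x → x + (δ (suc j) + 0) + 0) (∑-zero (All-range j) below) ⟩
    δ (suc j) + 0 + 0                                            ≡⟨ trans (+-identityʳ _) (+-identityʳ _) ⟩
    δ (suc j)                                                    ≡⟨ cong (λ b → if b then f (suc j) else 0) (≡ᵇ-refl j) ⟩
    f (suc j)                                                    ∎
    where
    m = n ∸ suc j
    δ : ℕ → ℕ
    δ x = if x ≡ᵇ suc j then f x else 0
    below : ∀ {x} → 1 ≤ x × x ≤ j → δ x ≡ 0
    below {x} (_ , x≤j) = cong (λ b → if b then f x else 0) (≢⇒≡ᵇ≡false (<⇒≢ (s≤s x≤j)))
    above : ∀ {x} → 1 ≤ x × x ≤ m → δ (suc j + x) ≡ 0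
    above {x} (1≤x , _) = cong (λ b → if b then f (suc j + x) else 0) (≢⇒≡ᵇ≡false (>⇒≢ (m<m+n (suc j) 1≤x)))

  ∑-cells-δ : ∀ λs {i j} c → InShape λs (i , j) → ∑ (cells λs) (λ u → if cellEq u (i , j) then c else 0) ≡ c
  ∑-cells-δ λs {i} {j} c ((1≤i , i≤k) , (1≤j , j≤r)) = begin
    ∑ (cells λs) δ                                 ≡⟨ ∑-concatMap (row λs) (range (length λs)) δ ⟩
    ∑ (range (length λs)) (λ x → ∑ (row λs x) δ)   ≡⟨ ∑-cong by-row (range (length λs)) ⟩
    ∑ (range (length λs)) (λ x → if x ≡ᵇ i then rowSum x else 0) ≡⟨ ∑-range-δ (length λs) rowSum 1≤i i≤k ⟩
    rowSum i                                        ≡⟨ ∑-range-δ (rowLen λs i) (λ _ → c) 1≤j j≤r ⟩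
    c                                              ∎
    where
    δ : Cell → ℕ
    δ u = if cellEq u (i , j) then c else 0
    rowSum : ℕ → ℕ
    rowSum x = ∑ (range (rowLen λs x)) (λ y → if y ≡ᵇ j then c else 0)
    on-row : ∀ x → ∑ (range (rowLen λs x)) (δ ∘ (x ,_)) ≡ (if x ≡ᵇ i then rowSum x else 0)
    on-row x with x ≡ᵇ i
    ... | true = refl
    ... | false = ∑-zero (All-range (rowLen λs x)) (λ _ → refl)
    by-row : ∀ x → ∑ (row λs x) δ ≡ (if x ≡ᵇ i then rowSum x else 0)
    by-row x = trans (∑-map (x ,_) (range (rowLen λs x)) δ) (on-row x)

  -- Descents, legs and inversions in concatenated shapes

  arms : List ℕ → Filling → ℕ
  arms λs S = ∑ (descents λs S) (arm λs)

  ∑-descents : ∀ λs S (w : Cell → ℕ) → ∑ (descents λs S) w ≡ ∑ (cells λs) (λ u → if isDescent S u then w u else 0)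
  ∑-descents λs S = ∑-filterᵇ (isDescent S) (cells λs)

  ∑-descents-cong : ∀ λs S {w w' : Cell → ℕ} → (∀ {u} → InShape λs u → w u ≡ w' u) →
    ∑ (descents λs S) w ≡ ∑ (descents λs S) w'
  ∑-descents-cong λs S {w} {w'} w≗w' = begin
    ∑ (descents λs S) w                                         ≡⟨ ∑-descents λs S w ⟩
    ∑ (cells λs) (λ u → if isDescent S u then w u else 0)       ≡⟨ ∑-cong-All (All-cells λs) (λ {u} u∈ → cong (λ x → if isDescent S u then x else 0) (w≗w' u∈)) ⟩
    ∑ (cells λs) (λ u → if isDescent S u then w' u else 0)      ≡⟨ ∑-descents λs S w' ⟨
    ∑ (descents λs S) w'                                        ∎

  isDescent-boundary : ∀ {k} S j → 1 ≤ k → isDescent S (k + 1 , j) ≡ (S k j <ᵇ S (k + 1) j)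
  isDescent-boundary {suc k} S j _ rewrite +-comm k 1 = refl

  isDescent-upperPart : ∀ k S {i} j → 2 ≤ i → isDescent S (k + i , j) ≡ isDescent (upperPart k S) (i , j)
  isDescent-upperPart k S {suc zero} j (s≤s ())
  isDescent-upperPart k S {suc (suc i)} j _ rewrite +-suc k (suc i) | +-suc k i = refl

  leg-++ : ∀ μ ν i j → leg (μ ++ ν) (i , j) ≡
    ∑ (range (length μ)) (λ r → 𝟙 ((i <ᵇ r) ∧ (j ≤ᵇ rowLen (μ ++ ν) r))) +
    ∑ (range (length ν)) (λ r → 𝟙 ((i <ᵇ length μ + r) ∧ (j ≤ᵇ rowLen (μ ++ ν) (length μ + r))))
  leg-++ μ ν i j = begin
    leg (μ ++ ν) (i , j)                              ≡⟨ count≡∑ above (range (length (μ ++ ν))) ⟩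
    ∑ (range (length (μ ++ ν))) (𝟙 ∘ above)           ≡⟨ cong (λ m → ∑ (range m) (𝟙 ∘ above)) (length-++ μ) ⟩
    ∑ (range (length μ + length ν)) (𝟙 ∘ above)       ≡⟨ cong (λ rs → ∑ rs (𝟙 ∘ above)) (range-+ (length μ) (length ν)) ⟩
    ∑ (range (length μ) ++ map (length μ +_) (range (length ν))) (𝟙 ∘ above)
                                                      ≡⟨ ∑-++ (range (length μ)) _ (𝟙 ∘ above) ⟩
    ∑ (range (length μ)) (𝟙 ∘ above) + ∑ (map (length μ +_) (range (length ν))) (𝟙 ∘ above)
                                                      ≡⟨ cong (∑ (range (length μ)) (𝟙 ∘ above) +_) (∑-map (length μ +_) (range (length ν)) (𝟙 ∘ above)) ⟩
    _                                                 ∎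
    where
    above : ℕ → Bool
    above r = (i <ᵇ r) ∧ (j ≤ᵇ rowLen (μ ++ ν) r)

  leg-++-lower : ∀ μ ν {i} j → i ≤ length μ →
    leg (μ ++ ν) (i , j) ≡ leg μ (i , j) + ∑ (range (length ν)) (λ r → 𝟙 (j ≤ᵇ rowLen ν r))
  leg-++-lower μ ν {i} j i≤k = trans (leg-++ μ ν i j) (cong₂ _+_ in-μ in-ν)
    where
    k = length μ
    in-μ : ∑ (range k) (λ r → 𝟙 ((i <ᵇ r) ∧ (j ≤ᵇ rowLen (μ ++ ν) r))) ≡ leg μ (i , j)
    in-μ = trans (∑-cong-All (All-range k) λ {r} (_ , r≤k) → cong (λ x → 𝟙 ((i <ᵇ r) ∧ (j ≤ᵇ x))) (rowLen-++ˡ μ ν r≤k))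
                 (sym (count≡∑ _ (range k)))
    in-ν : ∑ (range (length ν)) (λ r → 𝟙 ((i <ᵇ k + r) ∧ (j ≤ᵇ rowLen (μ ++ ν) (k + r)))) ≡
           ∑ (range (length ν)) (λ r → 𝟙 (j ≤ᵇ rowLen ν r))
    in-ν = ∑-cong-All (All-range (length ν)) λ { {suc r} _ →
             cong₂ (λ b x → 𝟙 (b ∧ (j ≤ᵇ x))) (<⇒<ᵇ≡true (≤-trans (s≤s i≤k) (m<m+n k (s≤s z≤n)))) (rowLen-++ʳ μ ν r) }

  leg-++-upper : ∀ μ ν i j → leg (μ ++ ν) (length μ + i , j) ≡ leg ν (i , j)
  leg-++-upper μ ν i j = begin
    leg (μ ++ ν) (k + i , j)                               ≡⟨ leg-++ μ ν (k + i) j ⟩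
    ∑ (range k) (λ r → 𝟙 ((k + i <ᵇ r) ∧ (j ≤ᵇ rowLen (μ ++ ν) r))) + in-ν
                                                           ≡⟨ cong (_+ in-ν) (∑-zero (All-range k) λ {r} (_ , r≤k) →
                                                                cong (λ b → 𝟙 (b ∧ (j ≤ᵇ rowLen (μ ++ ν) r))) (≥⇒<ᵇ≡false (≤-trans r≤k (m≤m+n k i)))) ⟩
    in-ν                                                   ≡⟨ ∑-cong-All (All-range (length ν)) (λ { {suc r} _ →
                                                                cong₂ (λ b x → 𝟙 (b ∧ (j ≤ᵇ x))) (+-<ᵇ k i (suc r)) (rowLen-++ʳ μ ν r) }) ⟩
    ∑ (range (length ν)) (λ r → 𝟙 ((i <ᵇ r) ∧ (j ≤ᵇ rowLen ν r))) ≡⟨ count≡∑ _ (range (length ν)) ⟨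
    leg ν (i , j)                                          ∎
    where
    k = length μ
    in-ν = ∑ (range (length ν)) (λ r → 𝟙 ((k + i <ᵇ k + r) ∧ (j ≤ᵇ rowLen (μ ++ ν) (k + r))))

  ∑-rows-rectangle : ∀ l j → ∑ (range (length (replicate l 2))) (λ r → 𝟙 (j ≤ᵇ rowLen (replicate l 2) r)) ≡ l * 𝟙 (j ≤ᵇ 2)
  ∑-rows-rectangle l j = begin
    ∑ (range (length (replicate l 2))) (λ r → 𝟙 (j ≤ᵇ rowLen (replicate l 2) r))
        ≡⟨ cong (λ m → ∑ (range m) (λ r → 𝟙 (j ≤ᵇ rowLen (replicate l 2) r))) (length-replicate l) ⟩
    ∑ (range l) (λ r → 𝟙 (j ≤ᵇ rowLen (replicate l 2) r))
        ≡⟨ ∑-cong-All (All-range l) (λ (1≤r , r≤l) → cong (λ x → 𝟙 (j ≤ᵇ x)) (rowLen-replicate l 2 1≤r r≤l)) ⟩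
    ∑ (range l) (λ _ → 𝟙 (j ≤ᵇ 2))   ≡⟨ ∑-const (range l) _ ⟩
    length (range l) * 𝟙 (j ≤ᵇ 2)    ≡⟨ cong (_* 𝟙 (j ≤ᵇ 2)) (length-range l) ⟩
    l * 𝟙 (j ≤ᵇ 2)                   ∎

  leg-rectangle-bottom : ∀ n {j} → j ≤ 2 → leg (replicate (suc n) 2) (1 , j) + 1 ≡ suc n
  leg-rectangle-bottom n {j} j≤2 = begin
    leg ([ 2 ] ++ replicate n 2) (1 , j) + 1   ≡⟨ cong (_+ 1) (leg-++-lower [ 2 ] (replicate n 2) j (s≤s z≤n)) ⟩
    0 + rows + 1                                ≡⟨ cong (_+ 1) (∑-rows-rectangle n j) ⟩
    n * 𝟙 (j ≤ᵇ 2) + 1                          ≡⟨ cong (λ b → n * 𝟙 b + 1) (≤⇒≤ᵇ≡true j≤2) ⟩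
    n * 1 + 1                                   ≡⟨ cong (_+ 1) (*-identityʳ n) ⟩
    n + 1                                       ≡⟨ +-comm n 1 ⟩
    suc n                                       ∎
    where rows = ∑ (range (length (replicate n 2))) (λ r → 𝟙 (j ≤ᵇ rowLen (replicate n 2) r))

  if-then-0≡*𝟙 : ∀ b m → (if b then m else 0) ≡ m * 𝟙 b
  if-then-0≡*𝟙 true m = sym (*-identityʳ m)
  if-then-0≡*𝟙 false m = sym (*-zeroʳ m)

  Inv≡∑∑ : ∀ λs S → Inv λs S ≡ ∑ (cells λs) (λ u → ∑ (cells λs) (λ v → 𝟙 (isInversion S (u , v))))
  Inv≡∑∑ λs S = begin
    count (isInversion S) (pairs (cells λs))                                ≡⟨ count≡∑ (isInversion S) (pairs (cells λs)) ⟩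
    ∑ (pairs (cells λs)) (𝟙 ∘ isInversion S)                                ≡⟨ ∑-concatMap (λ u → map (u ,_) (cells λs)) (cells λs) _ ⟩
    ∑ (cells λs) (λ u → ∑ (map (u ,_) (cells λs)) (𝟙 ∘ isInversion S))      ≡⟨ ∑-cong (λ u → ∑-map (u ,_) (cells λs) _) (cells λs) ⟩
    ∑ (cells λs) (λ u → ∑ (cells λs) (λ v → 𝟙 (isInversion S (u , v))))    ∎

  isInversion-above : ∀ S {iu iv} ju jv → iv < iu → isInversion S ((iu , ju) , (iv , jv)) ≡ false
  isInversion-above S {iu} {iv} ju jv iv<iu
    rewrite ≥⇒<ᵇ≡false {iu} {iv} (<⇒≤ iv<iu) | ≢⇒≡ᵇ≡false (<⇒≢ iv<iu) =
    trans (cong (attacks (iu , ju) (iv , jv) ∧_) (∧-zeroʳ (S iu ju <ᵇ S iv jv))) (∧-zeroʳ _)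

  isInversion-below : ∀ S {iu iv} ju jv → iu < iv →
    isInversion S ((iu , ju) , (iv , jv)) ≡ (iv ≡ᵇ suc iu) ∧ (ju <ᵇ jv) ∧ (S iu ju <ᵇ S iv jv)
  isInversion-below S {iu} {iv} ju jv iu<iv
    rewrite ≢⇒≡ᵇ≡false (<⇒≢ iu<iv) | ≢⇒≡ᵇ≡false (<⇒≢ (m<n⇒m<1+n iu<iv)) | <⇒<ᵇ≡true iu<iv
          | ∧-identityʳ (S iu ju <ᵇ S iv jv) = ∧-assoc (iv ≡ᵇ suc iu) (ju <ᵇ jv) _

  isInversion-shift : ∀ k S u v → isInversion S (shift k u , shift k v) ≡ isInversion (upperPart k S) (u , v)
  isInversion-shift zero S (iu , ju) (iv , jv) = refl
  isInversion-shift (suc k) S (iu , ju) (iv , jv) = isInversion-shift k (S ∘ suc) (iu , ju) (iv , jv)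

  -- Windows, and the conditions xAx and xXxX

  open import Data.Integer as ℤ using (ℤ; +_; -[1+_])

  sgn : ℕ → ℕ → ℤ
  sgn a b = + 𝟙 (a <ᵇ b) ℤ.- + 𝟙 (b <ᵇ a)

  window : ℕ → ℕ → ℕ → ℤ
  window a b c = + 𝟙 (c <ᵇ b) ℤ.- + 𝟙 (c <ᵇ a)

  separates : ℕ → ℕ → ℕ → Bool
  separates a b c = (c <ᵇ a) xor (c <ᵇ b)

  sgn-< : ∀ {a b} → a < b → sgn a b ≡ + 1
  sgn-< {a} {b} a<b rewrite <⇒<ᵇ≡true a<b | ≥⇒<ᵇ≡false {b} {a} (<⇒≤ a<b) = refl

  sgn-> : ∀ {a b} → b < a → sgn a b ≡ -[1+ 0 ]
  sgn-> {a} {b} b<a rewrite <⇒<ᵇ≡true b<a | ≥⇒<ᵇ≡false {a} {b} (<⇒≤ b<a) = refl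

  window-separates : ∀ a b c → window a b c ≡ (if separates a b c then sgn a b else + 0)
  window-separates a b c with c <ᵇ a in c<a | c <ᵇ b in c<b
  ... | true | true = refl
  ... | false | false = refl
  ... | false | true = sym (sgn-< (≤-<-trans (<ᵇ≡false⇒≥ c a c<a) (<ᵇ≡true⇒< c b c<b)))
  ... | true | false = sym (sgn-> (≤-<-trans (<ᵇ≡false⇒≥ c b c<b) (<ᵇ≡true⇒< c a c<a)))

  xAx≡separates : ∀ a b c → xAx a b c ≡ separates a b c
  xAx≡separates a b c rewrite ≤ᵇ≡not<ᵇ a c | ≤ᵇ≡not<ᵇ b c with c <ᵇ a | c <ᵇ b
  ... | true | true = refl
  ... | true | false = refl
  ... | false | true = refl
  ... | false | false = refl

  no-<-cycle : ∀ {w x y z} → w ≤ x → x < y → y ≤ z → z < w → ⊥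
  no-<-cycle w≤x x<y y≤z z<w = <-irrefl refl (≤-<-trans w≤x (<-trans x<y (≤-<-trans y≤z z<w)))

  xXxX≡separates-xor : ∀ a b A B → xXxX a b A B ≡ separates a b A xor separates a b B
  xXxX≡separates-xor a b A B
    rewrite ≤ᵇ≡not<ᵇ a A | ≤ᵇ≡not<ᵇ b A | ≤ᵇ≡not<ᵇ a B | ≤ᵇ≡not<ᵇ b B
    with A <ᵇ a in A<a | A <ᵇ b in A<b | B <ᵇ a in B<a | B <ᵇ b in B<b
  ... | true  | true  | true  | true  = refl
  ... | true  | true  | true  | false = refl
  ... | true  | true  | false | true  = refl
  ... | true  | true  | false | false = refl
  ... | true  | false | true  | true  = refl
  ... | true  | false | true  | false = refl
  ... | true  | false | false | true  =
    ⊥-elim (no-<-cycle (<ᵇ≡false⇒≥ A b A<b) (<ᵇ≡true⇒< A a A<a) (<ᵇ≡false⇒≥ B a B<a) (<ᵇ≡true⇒< B b B<b))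
  ... | true  | false | false | false = refl
  ... | false | true  | true  | true  = refl
  ... | false | true  | true  | false =
    ⊥-elim (no-<-cycle (<ᵇ≡false⇒≥ A a A<a) (<ᵇ≡true⇒< A b A<b) (<ᵇ≡false⇒≥ B b B<b) (<ᵇ≡true⇒< B a B<a))
  ... | false | true  | false | true  = refl
  ... | false | true  | false | false = refl
  ... | false | false | true  | true  = refl
  ... | false | false | true  | false = refl
  ... | false | false | false | true  = refl
  ... | false | false | false | false = refl

  window-xAx : ∀ a b c → xAx a b c ≡ true → window a b c ≡ sgn a b
  window-xAx a b c h rewrite window-separates a b c | sym (xAx≡separates a b c) | h = refl

  window-¬xAx : ∀ a b c → xAx a b c ≡ false → window a b c ≡ + 0
  window-¬xAx a b c h rewrite window-separates a b c | sym (xAx≡separates a b c) | h = refl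

  window-xXxX : ∀ a b A B → xXxX a b A B ≡ true → window a b A ℤ.+ window a b B ≡ sgn a b
  window-xXxX a b A B h rewrite window-separates a b A | window-separates a b B | xXxX≡separates-xor a b A B
    with separates a b A | separates a b B | h
  ... | true | false | _ = ℤ.+-identityʳ (sgn a b)
  ... | false | true | _ = ℤ.+-identityˡ (sgn a b)

  window-¬xXxX : ∀ a b A B → xXxX a b A B ≡ false → window a b A ≡ window a b B
  window-¬xXxX a b A B h rewrite window-separates a b A | window-separates a b B | xXxX≡separates-xor a b A B
    with separates a b A | separates a b B | h
  ... | true | true | _ = refl
  ... | false | false | _ = refl

  diff≡diff⇒sum≡sum : ∀ p q r s → + p ℤ.- + q ≡ + r ℤ.- + s → q + r ≡ s + p
  diff≡diff⇒sum≡sum p q r s h = ℤ.+-injective (begin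
    + (q + r)                                      ≡⟨ ℤ.pos-+ q r ⟩
    + q ℤ.+ + r                                    ≡⟨ expand (+ q) (+ r) (+ s) ⟩
    (+ r ℤ.- + s) ℤ.+ (+ s ℤ.+ + q)                ≡⟨ cong (ℤ._+ (+ s ℤ.+ + q)) h ⟨
    (+ p ℤ.- + q) ℤ.+ (+ s ℤ.+ + q)                ≡⟨ contract (+ p) (+ q) (+ s) ⟩
    + s ℤ.+ + p                                    ≡⟨ ℤ.pos-+ s p ⟨
    + (s + p)                                      ∎)
    where
    expand : ∀ q r s → q ℤ.+ r ≡ (r ℤ.- s) ℤ.+ (s ℤ.+ q)
    expand = ℤ-Ring.solve-∀
    contract : ∀ p q s → (p ℤ.- q) ℤ.+ (s ℤ.+ q) ≡ s ℤ.+ p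
    contract = ℤ-Ring.solve-∀

  -- Stacking a rectangle of width 2 on a shape

  module Stack (μ : List ℕ) (n : ℕ) (1≤k : 1 ≤ length μ) where

    private
      k = length μ
      ν = replicate (suc n) 2

    ∑-descents-stack : ∀ S (w : Cell → ℕ) → ∑ (descents (μ ++ ν) S) w ≡
      ∑ (descents μ S) w + ((if S k 1 <ᵇ S (k + 1) 1 then w (k + 1 , 1) else 0) +
                            ((if S k 2 <ᵇ S (k + 1) 2 then w (k + 1 , 2) else 0) +
                             ∑ (descents ν (upperPart k S)) (w ∘ shift k)))
    ∑-descents-stack S w = begin
      ∑ (descents (μ ++ ν) S) w                          ≡⟨ ∑-descents (μ ++ ν) S w ⟩
      ∑ (cells (μ ++ ν)) F                               ≡⟨ ∑-cells-++ μ ν F ⟩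
      ∑ (cells μ) F + ∑ (cells ν) (F ∘ shift k)          ≡⟨ cong₂ _+_ (sym (∑-descents μ S w)) (∑-cells-rectangle n (F ∘ shift k)) ⟩
      ∑ (descents μ S) w + (F (k + 1 , 1) + (F (k + 1 , 2) + ∑ (cells (replicate n 2)) (F ∘ shift k ∘ shift 1)))
          ≡⟨ cong (λ x → ∑ (descents μ S) w + x) (cong₂ _+_ (boundary 1) (cong₂ _+_ (boundary 2) interior)) ⟩
      _                                                  ∎
      where
      F : Cell → ℕ
      F u = if isDescent S u then w u else 0
      G : Cell → ℕ
      G u = if isDescent (upperPart k S) u then w (shift k u) else 0
      boundary : ∀ j → F (k + 1 , j) ≡ (if S k j <ᵇ S (k + 1) j then w (k + 1 , j) else 0)
      boundary j = cong (λ b → if b then w (k + 1 , j) else 0) (isDescent-boundary S j 1≤k)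
      interior : ∑ (cells (replicate n 2)) (F ∘ shift k ∘ shift 1) ≡ ∑ (descents ν (upperPart k S)) (w ∘ shift k)
      interior = begin
        ∑ (cells (replicate n 2)) (F ∘ shift k ∘ shift 1) ≡⟨ ∑-cong-All (All-cells (replicate n 2)) (λ { {i , j} ((1≤i , _) , _) →
                                                               cong (λ b → if b then w (k + suc i , j) else 0) (isDescent-upperPart k S j (s≤s 1≤i)) }) ⟩
        ∑ (cells (replicate n 2)) (G ∘ shift 1)           ≡⟨ ∑-cells-rectangle n G ⟨
        ∑ (cells ν) G                                      ≡⟨ ∑-descents ν (upperPart k S) (w ∘ shift k) ⟨
        ∑ (descents ν (upperPart k S)) (w ∘ shift k)       ∎

    leg-stack-below : ∀ {u} → InShape μ u → leg (μ ++ ν) u + 1 ≡ leg μ u + 1 + suc n * 𝟙 (proj₂ u ≤ᵇ 2)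
    leg-stack-below {i , j} ((_ , i≤k) , _) = begin
      leg (μ ++ ν) (i , j) + 1                     ≡⟨ cong (_+ 1) (leg-++-lower μ ν j i≤k) ⟩
      leg μ (i , j) + _ + 1                        ≡⟨ cong (λ x → leg μ (i , j) + x + 1) (∑-rows-rectangle (suc n) j) ⟩
      leg μ (i , j) + suc n * 𝟙 (j ≤ᵇ 2) + 1       ≡⟨ xy∙z≈xz∙y (leg μ (i , j)) _ 1 ⟩
      leg μ (i , j) + 1 + suc n * 𝟙 (j ≤ᵇ 2)       ∎

    leg-stack-boundary : ∀ {j} → j ≤ 2 → leg (μ ++ ν) (k + 1 , j) + 1 ≡ suc n
    leg-stack-boundary {j} j≤2 = trans (cong (_+ 1) (leg-++-upper μ ν 1 j)) (leg-rectangle-bottom n j≤2)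

    descentsUnderRectangle : Filling → ℕ
    descentsUnderRectangle S =
      ∑ (descents μ S) (λ (_ , j) → 𝟙 (j ≤ᵇ 2)) + (𝟙 (S k 1 <ᵇ S (k + 1) 1) + 𝟙 (S k 2 <ᵇ S (k + 1) 2))

    maj-stack : ∀ S → maj (μ ++ ν) S ≡ maj μ S + suc n * descentsUnderRectangle S + maj ν (upperPart k S)
    maj-stack S = begin
      maj (μ ++ ν) S                                     ≡⟨ ∑-descents-stack S W ⟩
      ∑ (descents μ S) W + (b 1 + (b 2 + ∑ (descents ν (upperPart k S)) (W ∘ shift k)))
          ≡⟨ cong₂ _+_ lower (cong₂ _+_ (boundary 1 (s≤s z≤n)) (cong₂ _+_ (boundary 2 ≤-refl) upper)) ⟩
      (maj μ S + l * Y) + (l * 𝟙 c₁ + (l * 𝟙 c₂ + maj ν (upperPart k S)))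
          ≡⟨ regroup (maj μ S) Y (𝟙 c₁) (𝟙 c₂) (maj ν (upperPart k S)) l ⟩
      maj μ S + l * descentsUnderRectangle S + maj ν (upperPart k S) ∎
      where
      l = suc n
      W : Cell → ℕ
      W u = leg (μ ++ ν) u + 1
      b : ℕ → ℕ
      b j = if S k j <ᵇ S (k + 1) j then W (k + 1 , j) else 0
      Y = ∑ (descents μ S) (λ (_ , j) → 𝟙 (j ≤ᵇ 2))
      c₁ = S k 1 <ᵇ S (k + 1) 1
      c₂ = S k 2 <ᵇ S (k + 1) 2
      regroup : ∀ a y b₁ b₂ r l → (a + l * y) + (l * b₁ + (l * b₂ + r)) ≡ a + l * (y + (b₁ + b₂)) + r
      regroup = solve-∀
      lower : ∑ (descents μ S) W ≡ maj μ S + l * Y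
      lower = begin
        ∑ (descents μ S) W                                                 ≡⟨ ∑-descents-cong μ S leg-stack-below ⟩
        ∑ (descents μ S) (λ u → (leg μ u + 1) + l * 𝟙 (proj₂ u ≤ᵇ 2))     ≡⟨ ∑-+ (descents μ S) _ _ ⟩
        maj μ S + ∑ (descents μ S) (λ u → l * 𝟙 (proj₂ u ≤ᵇ 2))           ≡⟨ cong (λ x → maj μ S + x) (∑-*ˡ l (descents μ S) _) ⟩
        maj μ S + l * Y                                                    ∎
      boundary : ∀ j → j ≤ 2 → b j ≡ l * 𝟙 (S k j <ᵇ S (k + 1) j)
      boundary j j≤2 = trans (cong (λ x → if S k j <ᵇ S (k + 1) j then x else 0) (leg-stack-boundary j≤2)) (if-then-0≡*𝟙 _ l)
      upper : ∑ (descents ν (upperPart k S)) (W ∘ shift k) ≡ maj ν (upperPart k S)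
      upper = ∑-descents-cong ν (upperPart k S) λ { {i , j} _ → cong (_+ 1) (leg-++-upper μ ν i j) }

    arms-stack : ∀ S → arms (μ ++ ν) S ≡ arms μ S + (𝟙 (S k 1 <ᵇ S (k + 1) 1) + arms ν (upperPart k S))
    arms-stack S = begin
      arms (μ ++ ν) S                                   ≡⟨ ∑-descents-stack S (arm (μ ++ ν)) ⟩
      ∑ (descents μ S) (arm (μ ++ ν)) + (b₁ + (b₂ + ∑ (descents ν (upperPart k S)) (arm (μ ++ ν) ∘ shift k)))
          ≡⟨ cong₂ _+_ lower (cong₂ _+_ top-left (cong₂ _+_ top-right upper)) ⟩
      arms μ S + (𝟙 (S k 1 <ᵇ S (k + 1) 1) + (0 + arms ν (upperPart k S))) ∎
      where
      b₁ = if S k 1 <ᵇ S (k + 1) 1 then arm (μ ++ ν) (k + 1 , 1) else 0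
      b₂ = if S k 2 <ᵇ S (k + 1) 2 then arm (μ ++ ν) (k + 1 , 2) else 0
      lower : ∑ (descents μ S) (arm (μ ++ ν)) ≡ arms μ S
      lower = ∑-descents-cong μ S λ { {i , j} ((_ , i≤k) , _) → cong (_∸ j) (rowLen-++ˡ μ ν i≤k) }
      top-left : b₁ ≡ 𝟙 (S k 1 <ᵇ S (k + 1) 1)
      top-left = cong (λ r → if S k 1 <ᵇ S (k + 1) 1 then r ∸ 1 else 0) (rowLen-++ʳ μ ν 0)
      top-right : b₂ ≡ 0
      top-right = trans (cong (λ r → if S k 2 <ᵇ S (k + 1) 2 then r ∸ 2 else 0) (rowLen-++ʳ μ ν 0)) (if-then-0≡*𝟙 _ 0)
      upper : ∑ (descents ν (upperPart k S)) (arm (μ ++ ν) ∘ shift k) ≡ arms ν (upperPart k S)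
      upper = ∑-descents-cong ν (upperPart k S) λ { {suc i , j} _ → cong (_∸ j) (rowLen-++ʳ μ ν i) }

    inversions-across-cell : ∀ S {u} → InShape μ u →
      ∑ (cells ν) (λ v → 𝟙 (isInversion S (u , shift k v))) ≡ (if cellEq u (k , 1) then 𝟙 (S k 1 <ᵇ S (k + 1) 2) else 0)
    inversions-across-cell S {iu , suc ju} ((_ , iu≤k) , _) = begin
      ∑ (cells ν) (h u ∘ shift k)                           ≡⟨ ∑-cells-rectangle n (h u ∘ shift k) ⟩
      H 1 + (H 2 + ∑ (cells (replicate n 2)) (h u ∘ shift k ∘ shift 1))
                                                            ≡⟨ cong (λ x → H 1 + (H 2 + x)) (∑-zero (All-cells (replicate n 2)) far) ⟩
      H 1 + (H 2 + 0)                                       ≡⟨ adjacent-row (iu ≟ k) ⟩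
      (if cellEq u (k , 1) then 𝟙 c else 0)                 ∎
      where
      c = S k 1 <ᵇ S (k + 1) 2
      h : Cell → Cell → ℕ
      h u v = 𝟙 (isInversion S (u , v))
      u = iu , suc ju
      H : ℕ → ℕ
      H j = h u (k + 1 , j)
      k+1≡ᵇ1+k : (k + 1 ≡ᵇ suc k) ≡ true
      k+1≡ᵇ1+k = trans (cong (_≡ᵇ suc k) (+-comm k 1)) (≡ᵇ-refl (suc k))
      far : ∀ {v} → InShape (replicate n 2) v → h u (shift k (shift 1 v)) ≡ 0
      far {i , j} ((1≤i , _) , _) = cong 𝟙 (trans (isInversion-below S (suc ju) j (≤-trans (s≤s iu≤k) (m<m+n k (s≤s z≤n))))
                                                (cong (_∧ ((suc ju <ᵇ j) ∧ (S iu (suc ju) <ᵇ S (k + suc i) j)))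
                                                      (≢⇒≡ᵇ≡false (>⇒≢ two-rows-up))))
        where
        two-rows-up : suc iu < k + suc i
        two-rows-up = ≤-trans (s≤s (s≤s iu≤k)) (subst (suc (suc k) ≤_) (sym (+-suc k i)) (s≤s (m<m+n k 1≤i)))
      iu<k+1 : iu < k + 1
      iu<k+1 = subst (iu <_) (+-comm 1 k) (s≤s iu≤k)
      adjacent-row : Dec (iu ≡ k) → H 1 + (H 2 + 0) ≡ (if cellEq u (k , 1) then 𝟙 c else 0)
      adjacent-row (no iu≢k)
        rewrite isInversion-below S (suc ju) 1 iu<k+1 | isInversion-below S (suc ju) 2 iu<k+1
              | ≢⇒≡ᵇ≡false {k + 1} {suc iu} (λ e → iu≢k (suc-injective (trans (sym e) (+-comm k 1))))
              | ≢⇒≡ᵇ≡false iu≢k = refl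
      adjacent-row (yes refl)
        rewrite isInversion-below S (suc ju) 1 iu<k+1 | isInversion-below S (suc ju) 2 iu<k+1
              | k+1≡ᵇ1+k | ≡ᵇ-refl k = corner ju
        where
        corner : ∀ j → 𝟙 ((suc j <ᵇ 2) ∧ (S k (suc j) <ᵇ S (k + 1) 2)) + 0 ≡ (if suc j ≡ᵇ 1 then 𝟙 c else 0)
        corner zero = +-identityʳ (𝟙 c)
        corner (suc j) = refl

    inversions-across : ∀ S → 1 ≤ rowLen μ k →
      ∑ (cells μ) (λ u → ∑ (cells ν) (λ v → 𝟙 (isInversion S (u , shift k v)))) ≡ 𝟙 (S k 1 <ᵇ S (k + 1) 2)
    inversions-across S 1≤r =
      trans (∑-cong-All (All-cells μ) (inversions-across-cell S)) (∑-cells-δ μ _ ((1≤k , ≤-refl) , (s≤s z≤n , 1≤r)))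

    Inv-stack : ∀ S → 1 ≤ rowLen μ k → Inv (μ ++ ν) S ≡ Inv μ S + (𝟙 (S k 1 <ᵇ S (k + 1) 2) + Inv ν (upperPart k S))
    Inv-stack S 1≤r = begin
      Inv (μ ++ ν) S                                          ≡⟨ Inv≡∑∑ (μ ++ ν) S ⟩
      ∑ (cells (μ ++ ν)) (λ u → ∑ (cells (μ ++ ν)) (h u))    ≡⟨ ∑-cong (λ u → ∑-cells-++ μ ν (h u)) (cells (μ ++ ν)) ⟩
      ∑ (cells (μ ++ ν)) (λ u → P u + Q u)                    ≡⟨ ∑-cells-++ μ ν (λ u → P u + Q u) ⟩
      ∑ (cells μ) (λ u → P u + Q u) + ∑ (cells ν) (λ w → P (shift k w) + Q (shift k w))
          ≡⟨ cong₂ _+_ (∑-+ (cells μ) P Q) (∑-+ (cells ν) (P ∘ shift k) (Q ∘ shift k)) ⟩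
      (∑ (cells μ) P + ∑ (cells μ) Q) + (∑ (cells ν) (P ∘ shift k) + ∑ (cells ν) (Q ∘ shift k))
          ≡⟨ cong₂ _+_ (cong₂ _+_ (sym (Inv≡∑∑ μ S)) (inversions-across S 1≤r)) (cong₂ _+_ from-above within-ν) ⟩
      (Inv μ S + 𝟙 c) + (0 + Inv ν (upperPart k S))          ≡⟨ +-assoc (Inv μ S) (𝟙 c) _ ⟩
      Inv μ S + (𝟙 c + Inv ν (upperPart k S))                ∎
      where
      c = S k 1 <ᵇ S (k + 1) 2
      h : Cell → Cell → ℕ
      h u v = 𝟙 (isInversion S (u , v))
      P Q : Cell → ℕ
      P u = ∑ (cells μ) (h u)
      Q u = ∑ (cells ν) (h u ∘ shift k)
      from-above : ∑ (cells ν) (P ∘ shift k) ≡ 0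
      from-above = ∑-zero (All-cells ν) λ { {i , j} ((1≤i , _) , _) →
                   ∑-zero (All-cells μ) λ { {i' , j'} ((_ , i'≤k) , _) →
                   cong 𝟙 (isInversion-above S j j' (≤-trans (s≤s i'≤k) (m<m+n k 1≤i))) } }
      within-ν : ∑ (cells ν) (Q ∘ shift k) ≡ Inv ν (upperPart k S)
      within-ν = trans (∑-cong (λ u → ∑-cong (λ v → cong 𝟙 (isInversion-shift k S u v)) (cells ν)) (cells ν))
                       (sym (Inv≡∑∑ ν (upperPart k S)))

    inv-stack : ∀ S → 1 ≤ rowLen μ k →
      inv (μ ++ ν) S ≡ inv μ S ℤ.+ inv ν (upperPart k S) ℤ.+ window (S (k + 1) 1) (S (k + 1) 2) (S k 1)
    inv-stack S 1≤r = begin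
      + Inv (μ ++ ν) S ℤ.- + arms (μ ++ ν) S
          ≡⟨ cong₂ (λ i a → + i ℤ.- + a) (Inv-stack S 1≤r) (arms-stack S) ⟩
      + (Inv μ S + (𝟙 c₂ + Inv ν (upperPart k S))) ℤ.- + (arms μ S + (𝟙 c₁ + arms ν (upperPart k S)))
          ≡⟨ cong₂ ℤ._-_ (+-+-+ (Inv μ S) (𝟙 c₂) _) (+-+-+ (arms μ S) (𝟙 c₁) _) ⟩
      (+ Inv μ S ℤ.+ (+ 𝟙 c₂ ℤ.+ + Inv ν (upperPart k S))) ℤ.- (+ arms μ S ℤ.+ (+ 𝟙 c₁ ℤ.+ + arms ν (upperPart k S)))
          ≡⟨ regroup (+ Inv μ S) (+ 𝟙 c₂) (+ Inv ν (upperPart k S)) (+ arms μ S) (+ 𝟙 c₁) (+ arms ν (upperPart k S)) ⟩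
      inv μ S ℤ.+ inv ν (upperPart k S) ℤ.+ (+ 𝟙 c₂ ℤ.- + 𝟙 c₁) ∎
      where
      c₁ = S k 1 <ᵇ S (k + 1) 1
      c₂ = S k 1 <ᵇ S (k + 1) 2
      +-+-+ : ∀ a b c → + (a + (b + c)) ≡ + a ℤ.+ (+ b ℤ.+ + c)
      +-+-+ a b c = trans (ℤ.pos-+ a (b + c)) (cong (λ x → + a ℤ.+ x) (ℤ.pos-+ b c))
      regroup : ∀ i b i' a c a' → (i ℤ.+ (b ℤ.+ i')) ℤ.- (a ℤ.+ (c ℤ.+ a')) ≡ (i ℤ.- a) ℤ.+ (i' ℤ.- a') ℤ.+ (b ℤ.- c)
      regroup = ℤ-Ring.solve-∀

  -- Row 0 of upperPart k S is row k of S, so agreement is only required from row 1 on.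
  AgreeOnRows : ℕ → Filling → Filling → Set
  AgreeOnRows N S T = ∀ i j → 1 ≤ i → i ≤ N → S i j ≡ T i j

  isDescent-agree : ∀ {N S T} → AgreeOnRows N S T → ∀ {i} j → i ≤ N → isDescent S (i , j) ≡ isDescent T (i , j)
  isDescent-agree S≐T {zero} j _ = refl
  isDescent-agree S≐T {suc zero} j _ = refl
  isDescent-agree S≐T {suc (suc i)} j i≤N =
    cong₂ _<ᵇ_ (S≐T (suc i) j (s≤s z≤n) (≤-trans (n≤1+n _) i≤N)) (S≐T (suc (suc i)) j (s≤s z≤n) i≤N)

  ∑-descents-agree : ∀ λs {S T} (w : Cell → ℕ) → AgreeOnRows (length λs) S T → ∑ (descents λs S) w ≡ ∑ (descents λs T) w
  ∑-descents-agree λs {S} {T} w S≐T = begin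
    ∑ (descents λs S) w                                      ≡⟨ ∑-descents λs S w ⟩
    ∑ (cells λs) (λ u → if isDescent S u then w u else 0)    ≡⟨ ∑-cong-All (All-cells λs) (λ { {i , j} ((_ , i≤N) , _) →
                                                                   cong (λ b → if b then w (i , j) else 0) (isDescent-agree S≐T j i≤N) }) ⟩
    ∑ (cells λs) (λ u → if isDescent T u then w u else 0)    ≡⟨ ∑-descents λs T w ⟨
    ∑ (descents λs T) w                                      ∎

  Inv-agree : ∀ λs {S T} → AgreeOnRows (length λs) S T → Inv λs S ≡ Inv λs T
  Inv-agree λs {S} {T} S≐T = begin
    Inv λs S                                                 ≡⟨ Inv≡∑∑ λs S ⟩
    ∑ (cells λs) (λ u → ∑ (cells λs) (λ v → 𝟙 (isInversion S (u , v))))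
        ≡⟨ ∑-cong-All (All-cells λs) (λ { {iu , ju} ((1≤iu , iu≤N) , _) → ∑-cong-All (All-cells λs) (λ { {iv , jv} ((1≤iv , iv≤N) , _) →
             cong₂ (λ x y → 𝟙 (attacks (iu , ju) (iv , jv) ∧ (x <ᵇ y) ∧ precedes (iv , jv) (iu , ju)))
                   (S≐T iu ju 1≤iu iu≤N) (S≐T iv jv 1≤iv iv≤N) }) }) ⟩
    ∑ (cells λs) (λ u → ∑ (cells λs) (λ v → 𝟙 (isInversion T (u , v)))) ≡⟨ Inv≡∑∑ λs T ⟨
    Inv λs T                                                 ∎

  maj-agree : ∀ λs {S T} → AgreeOnRows (length λs) S T → maj λs S ≡ maj λs T
  maj-agree λs = ∑-descents-agree λs (λ u → leg λs u + 1)

  inv-agree : ∀ λs {S T} → AgreeOnRows (length λs) S T → inv λs S ≡ inv λs T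
  inv-agree λs S≐T = cong₂ (λ i a → + i ℤ.- + a) (Inv-agree λs S≐T) (∑-descents-agree λs (arm λs) S≐T)

  infix 4 _≈_
  _≈_ : Filling → Filling → Set
  S ≈ T = ∀ i j → S i j ≡ T i j

  ≈⇒AgreeOnRows : ∀ {N S T} → S ≈ T → AgreeOnRows N S T
  ≈⇒AgreeOnRows S≈T i j _ _ = S≈T i j

  swapColumn : ℕ → ℕ
  swapColumn 1 = 2
  swapColumn 2 = 1
  swapColumn j = j

  swapRow-≡ : ∀ S r i j → swapRow S r i j ≡ (if i ≡ᵇ r then S i (swapColumn j) else S i j)
  swapRow-≡ S r i 0 with i ≡ᵇ r
  ... | true = refl
  ... | false = refl
  swapRow-≡ S r i 1 with i ≡ᵇ r
  ... | true = refl
  ... | false = refl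
  swapRow-≡ S r i 2 with i ≡ᵇ r
  ... | true = refl
  ... | false = refl
  swapRow-≡ S r i (suc (suc (suc j))) with i ≡ᵇ r
  ... | true = refl
  ... | false = refl

  swapRow-other : ∀ S {r i} j → i ≢ r → swapRow S r i j ≡ S i j
  swapRow-other S {r} {i} j i≢r = trans (swapRow-≡ S r i j) (cong (λ b → if b then S i (swapColumn j) else S i j) (≢⇒≡ᵇ≡false i≢r))

  swapRow-cong : ∀ {S T} → S ≈ T → ∀ r → swapRow S r ≈ swapRow T r
  swapRow-cong {S} {T} S≈T r i j = begin
    swapRow S r i j                                          ≡⟨ swapRow-≡ S r i j ⟩
    (if i ≡ᵇ r then S i (swapColumn j) else S i j)           ≡⟨ cong₂ (if i ≡ᵇ r then_else_) (S≈T i (swapColumn j)) (S≈T i j) ⟩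
    (if i ≡ᵇ r then T i (swapColumn j) else T i j)           ≡⟨ swapRow-≡ T r i j ⟨
    swapRow T r i j                                          ∎

  upperPart-swapRow : ∀ k S r → upperPart k (swapRow S (k + r)) ≈ swapRow (upperPart k S) r
  upperPart-swapRow k S r i j = begin
    swapRow S (k + r) (k + i) j                                            ≡⟨ swapRow-≡ S (k + r) (k + i) j ⟩
    (if k + i ≡ᵇ k + r then S (k + i) (swapColumn j) else S (k + i) j)     ≡⟨ cong (if_then S (k + i) (swapColumn j) else S (k + i) j) (+-≡ᵇ k i r) ⟩
    (if i ≡ᵇ r then S (k + i) (swapColumn j) else S (k + i) j)             ≡⟨ swapRow-≡ (upperPart k S) r i j ⟨
    swapRow (upperPart k S) r i j                                          ∎

  rowsXXXX-cong : ∀ {S T} → S ≈ T → ∀ r → rowsXXXX S r ≡ rowsXXXX T r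
  rowsXXXX-cong S≈T r rewrite S≈T (suc r) 1 | S≈T (suc r) 2 | S≈T r 1 | S≈T r 2 = refl

  rowsXXXX-upperPart : ∀ k S r → rowsXXXX S (k + r) ≡ rowsXXXX (upperPart k S) r
  rowsXXXX-upperPart k S r = cong (λ r' → xXxX (S r' 1) (S r' 2) (S (k + r) 1) (S (k + r) 2)) (sym (+-suc k r))

  tauLoop-cong : ∀ n {S T} → S ≈ T → ∀ r → tauLoop n S r ≈ tauLoop n T r
  tauLoop-cong zero S≈T r = S≈T
  tauLoop-cong (suc n) {S} {T} S≈T r i j rewrite rowsXXXX-cong S≈T r with rowsXXXX T r
  ... | true = tauLoop-cong n (swapRow-cong S≈T (suc r)) (suc r) i j
  ... | false = S≈T i j

  tauLoop-below : ∀ n S r {i} j → i ≤ r → tauLoop n S r i j ≡ S i j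
  tauLoop-below zero S r j i≤r = refl
  tauLoop-below (suc n) S r j i≤r with rowsXXXX S r
  ... | true = trans (tauLoop-below n (swapRow S (suc r)) (suc r) j (m≤n⇒m≤1+n i≤r)) (swapRow-other S j (<⇒≢ (s≤s i≤r)))
  ... | false = refl

  tauLoop-agree : ∀ n S r → AgreeOnRows r (tauLoop n S r) S
  tauLoop-agree n S r i j _ = tauLoop-below n S r j

  upperPart-tauLoop : ∀ k n S r → upperPart k (tauLoop n S (k + r)) ≈ tauLoop n (upperPart k S) r
  upperPart-tauLoop k zero S r i j = refl
  upperPart-tauLoop k (suc n) S r i j rewrite rowsXXXX-upperPart k S r with rowsXXXX (upperPart k S) r
  ... | true = begin
    tauLoop n (swapRow S (suc (k + r))) (suc (k + r)) (k + i) j     ≡⟨ cong (λ r' → tauLoop n (swapRow S r') r' (k + i) j) (sym (+-suc k r)) ⟩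
    tauLoop n (swapRow S (k + suc r)) (k + suc r) (k + i) j         ≡⟨ upperPart-tauLoop k n (swapRow S (k + suc r)) (suc r) i j ⟩
    tauLoop n (upperPart k (swapRow S (k + suc r))) (suc r) i j     ≡⟨ tauLoop-cong n (upperPart-swapRow k S (suc r)) (suc r) i j ⟩
    tauLoop n (swapRow (upperPart k S) (suc r)) (suc r) i j         ∎
  ... | false = refl

  -- The cascade on a rectangle of width 2

  cascade : ℕ → Filling → Filling
  cascade n R = tauLoop n (swapRow R 1) 1

  upperPart-loop≈cascade : ∀ k n T → upperPart k (tauLoop n (swapRow T (suc k)) (suc k)) ≈ cascade n (upperPart k T)
  upperPart-loop≈cascade k n T i j = begin
    tauLoop n (swapRow T (suc k)) (suc k) (k + i) j    ≡⟨ cong (λ r → tauLoop n (swapRow T r) r (k + i) j) (+-comm 1 k) ⟩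
    tauLoop n (swapRow T (k + 1)) (k + 1) (k + i) j    ≡⟨ upperPart-tauLoop k n (swapRow T (k + 1)) 1 i j ⟩
    tauLoop n (upperPart k (swapRow T (k + 1))) 1 i j  ≡⟨ tauLoop-cong n (upperPart-swapRow k T 1) 1 i j ⟩
    cascade n (upperPart k T) i j                      ∎

  bottomDescents : Filling → ℕ
  bottomDescents X = 𝟙 (X 1 1 <ᵇ X 2 1) + 𝟙 (X 1 2 <ᵇ X 2 2)

  bottomInv : Filling → ℤ
  bottomInv X = + 𝟙 (X 1 2 <ᵇ X 1 1) ℤ.+ window (X 2 1) (X 2 2) (X 1 1)

  bottomDescents-agree : ∀ {S T} → AgreeOnRows 2 S T → bottomDescents S ≡ bottomDescents T
  bottomDescents-agree S≐T = cong₂ _+_ (cong₂ (λ x y → 𝟙 (x <ᵇ y)) (S≐T 1 1 (s≤s z≤n) (s≤s z≤n)) (S≐T 2 1 (s≤s z≤n) ≤-refl))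
                                    (cong₂ (λ x y → 𝟙 (x <ᵇ y)) (S≐T 1 2 (s≤s z≤n) (s≤s z≤n)) (S≐T 2 2 (s≤s z≤n) ≤-refl))

  bottomInv-agree : ∀ {S T} → AgreeOnRows 2 S T → bottomInv S ≡ bottomInv T
  bottomInv-agree {S} {T} S≐T
    rewrite S≐T 1 1 (s≤s z≤n) (s≤s z≤n) | S≐T 1 2 (s≤s z≤n) (s≤s z≤n) | S≐T 2 1 (s≤s z≤n) ≤-refl | S≐T 2 2 (s≤s z≤n) ≤-refl = refl

  bottomDescents-swapRow : ∀ R → window (R 2 1) (R 2 2) (R 1 2) ≡ window (R 2 1) (R 2 2) (R 1 1) →
    bottomDescents (swapRow R 1) ≡ bottomDescents R
  bottomDescents-swapRow R = diff≡diff⇒sum≡sum (𝟙 (R 1 2 <ᵇ R 2 2)) (𝟙 (R 1 2 <ᵇ R 2 1)) (𝟙 (R 1 1 <ᵇ R 2 2)) (𝟙 (R 1 1 <ᵇ R 2 1))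

  maj-rectangle : ∀ m X → maj (replicate (2 + m) 2) X ≡ suc m * bottomDescents X + maj (replicate (suc m) 2) (upperPart 1 X)
  maj-rectangle m = Stack.maj-stack [ 2 ] m (s≤s z≤n)

  inv-row : ∀ X → inv [ 2 ] X ≡ + 𝟙 (X 1 2 <ᵇ X 1 1)
  inv-row X = trans (ℤ.+-identityʳ (+ Inv [ 2 ] X)) (cong +_ Inv-row)
    where
    Inv-row : Inv [ 2 ] X ≡ 𝟙 (X 1 2 <ᵇ X 1 1)
    Inv-row rewrite ∧-zeroʳ (X 1 1 <ᵇ X 1 2) | ∧-identityʳ (X 1 2 <ᵇ X 1 1) with X 1 2 <ᵇ X 1 1
    ... | true = refl
    ... | false = refl

  inv-rectangle : ∀ m X → inv (replicate (2 + m) 2) X ≡ inv (replicate (suc m) 2) (upperPart 1 X) ℤ.+ bottomInv X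
  inv-rectangle m X = begin
    inv (replicate (2 + m) 2) X                                 ≡⟨ Stack.inv-stack [ 2 ] m (s≤s z≤n) X (s≤s z≤n) ⟩
    inv [ 2 ] X ℤ.+ I ℤ.+ window (X 2 1) (X 2 2) (X 1 1)       ≡⟨ cong (λ x → x ℤ.+ I ℤ.+ window (X 2 1) (X 2 2) (X 1 1)) (inv-row X) ⟩
    + 𝟙 (X 1 2 <ᵇ X 1 1) ℤ.+ I ℤ.+ window (X 2 1) (X 2 2) (X 1 1) ≡⟨ swap-first (+ 𝟙 (X 1 2 <ᵇ X 1 1)) I _ ⟩
    I ℤ.+ bottomInv X                                           ∎
    where
    I = inv (replicate (suc m) 2) (upperPart 1 X)
    swap-first : ∀ a i w → a ℤ.+ i ℤ.+ w ≡ i ℤ.+ (a ℤ.+ w)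
    swap-first = ℤ-Ring.solve-∀

  upperPart-swapRow-below : ∀ {N} R → AgreeOnRows N (upperPart 1 (swapRow R 1)) (upperPart 1 R)
  upperPart-swapRow-below R (suc i) j _ _ = refl

  maj-cascade : ∀ n R → maj (replicate (suc n) 2) (cascade n R) ≡ maj (replicate (suc n) 2) R
  maj-cascade zero R = refl
  maj-cascade (suc m) R with rowsXXXX (swapRow R 1) 1 in rows₁₂
  ... | false = begin
    maj μ W                                                 ≡⟨ maj-rectangle m W ⟩
    suc m * bottomDescents W + maj ν (upperPart 1 W)           ≡⟨ cong₂ (λ d x → suc m * d + x) unchanged (maj-agree ν (upperPart-swapRow-below R)) ⟩
    suc m * bottomDescents R + maj ν (upperPart 1 R)           ≡⟨ maj-rectangle m R ⟨
    maj μ R                                                 ∎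
    where
    μ = replicate (2 + m) 2
    ν = replicate (suc m) 2
    W = swapRow R 1
    unchanged : bottomDescents W ≡ bottomDescents R
    unchanged = bottomDescents-swapRow R (window-¬xXxX (R 2 1) (R 2 2) (R 1 2) (R 1 1) rows₁₂)
  ... | true = begin
    maj μ L                                                 ≡⟨ maj-rectangle m L ⟩
    suc m * bottomDescents L + maj ν (upperPart 1 L)           ≡⟨ cong₂ (λ d x → suc m * d + x) bottom upper ⟩
    suc m * bottomDescents R + maj ν (upperPart 1 R)           ≡⟨ maj-rectangle m R ⟨
    maj μ R                                                 ∎
    where
    μ = replicate (2 + m) 2
    ν = replicate (suc m) 2
    W = swapRow R 1
    L = tauLoop m (swapRow W 2) 2
    bottom : bottomDescents L ≡ bottomDescents R
    bottom = trans (bottomDescents-agree (tauLoop-agree m (swapRow W 2) 2)) (+-comm (𝟙 (R 1 2 <ᵇ R 2 2)) (𝟙 (R 1 1 <ᵇ R 2 1)))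
    upper : maj ν (upperPart 1 L) ≡ maj ν (upperPart 1 R)
    upper = begin
      maj ν (upperPart 1 L)                 ≡⟨ maj-agree ν (≈⇒AgreeOnRows (upperPart-loop≈cascade 1 m W)) ⟩
      maj ν (cascade m (upperPart 1 W))     ≡⟨ maj-cascade m (upperPart 1 W) ⟩
      maj ν (upperPart 1 W)                 ≡⟨ maj-agree ν (upperPart-swapRow-below R) ⟩
      maj ν (upperPart 1 R)                 ∎

  inv-cascade : ∀ n R → inv (replicate (suc n) 2) (cascade n R) ≡ inv (replicate (suc n) 2) R ℤ.+ sgn (R 1 1) (R 1 2)
  inv-cascade zero R = begin
    inv [ 2 ] (swapRow R 1)                          ≡⟨ inv-row (swapRow R 1) ⟩
    + 𝟙 (R 1 1 <ᵇ R 1 2)                             ≡⟨ split (+ 𝟙 (R 1 1 <ᵇ R 1 2)) (+ 𝟙 (R 1 2 <ᵇ R 1 1)) ⟩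
    + 𝟙 (R 1 2 <ᵇ R 1 1) ℤ.+ sgn (R 1 1) (R 1 2)     ≡⟨ cong (ℤ._+ sgn (R 1 1) (R 1 2)) (inv-row R) ⟨
    inv [ 2 ] R ℤ.+ sgn (R 1 1) (R 1 2)              ∎
    where
    split : ∀ x y → x ≡ y ℤ.+ (x ℤ.- y)
    split = ℤ-Ring.solve-∀
  inv-cascade (suc m) R with rowsXXXX (swapRow R 1) 1 in rows₁₂
  ... | false = begin
    inv μ W                                                   ≡⟨ inv-rectangle m W ⟩
    inv ν (upperPart 1 W) ℤ.+ bottomInv W                     ≡⟨ cong₂ (λ i w → i ℤ.+ (x ℤ.+ w)) (inv-agree ν (upperPart-swapRow-below R)) unchanged ⟩
    I ℤ.+ (x ℤ.+ window (R 2 1) (R 2 2) (R 1 1))              ≡⟨ shuffle I x y (window (R 2 1) (R 2 2) (R 1 1)) ⟩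
    I ℤ.+ bottomInv R ℤ.+ sgn (R 1 1) (R 1 2)                 ≡⟨ cong (ℤ._+ sgn (R 1 1) (R 1 2)) (inv-rectangle m R) ⟨
    inv μ R ℤ.+ sgn (R 1 1) (R 1 2)                           ∎
    where
    μ = replicate (2 + m) 2
    ν = replicate (suc m) 2
    W = swapRow R 1
    I = inv ν (upperPart 1 R)
    x = + 𝟙 (R 1 1 <ᵇ R 1 2)
    y = + 𝟙 (R 1 2 <ᵇ R 1 1)
    unchanged : window (R 2 1) (R 2 2) (R 1 2) ≡ window (R 2 1) (R 2 2) (R 1 1)
    unchanged = window-¬xXxX (R 2 1) (R 2 2) (R 1 2) (R 1 1) rows₁₂
    shuffle : ∀ I x y w → I ℤ.+ (x ℤ.+ w) ≡ I ℤ.+ (y ℤ.+ w) ℤ.+ (x ℤ.- y)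
    shuffle = ℤ-Ring.solve-∀
  ... | true = begin
    inv μ L                                                   ≡⟨ inv-rectangle m L ⟩
    inv ν (upperPart 1 L) ℤ.+ bottomInv L                     ≡⟨ cong₂ ℤ._+_ upper (bottomInv-agree (tauLoop-agree m (swapRow W 2) 2)) ⟩
    I ℤ.+ sgn (R 2 1) (R 2 2) ℤ.+ bottomInv (swapRow W 2)     ≡⟨ cong (λ s → I ℤ.+ s ℤ.+ bottomInv (swapRow W 2)) (window-xXxX (R 2 1) (R 2 2) (R 1 2) (R 1 1) rows₁₂) ⟨
    I ℤ.+ (p ℤ.- q ℤ.+ (s ℤ.- t)) ℤ.+ (x ℤ.+ (q ℤ.- p))       ≡⟨ shuffle I x y p q s t ⟩
    I ℤ.+ bottomInv R ℤ.+ sgn (R 1 1) (R 1 2)                 ≡⟨ cong (ℤ._+ sgn (R 1 1) (R 1 2)) (inv-rectangle m R) ⟨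
    inv μ R ℤ.+ sgn (R 1 1) (R 1 2)                           ∎
    where
    μ = replicate (2 + m) 2
    ν = replicate (suc m) 2
    W = swapRow R 1
    L = tauLoop m (swapRow W 2) 2
    I = inv ν (upperPart 1 R)
    x = + 𝟙 (R 1 1 <ᵇ R 1 2)
    y = + 𝟙 (R 1 2 <ᵇ R 1 1)
    p = + 𝟙 (R 1 2 <ᵇ R 2 2)
    q = + 𝟙 (R 1 2 <ᵇ R 2 1)
    s = + 𝟙 (R 1 1 <ᵇ R 2 2)
    t = + 𝟙 (R 1 1 <ᵇ R 2 1)
    upper : inv ν (upperPart 1 L) ≡ I ℤ.+ sgn (R 2 1) (R 2 2)
    upper = begin
      inv ν (upperPart 1 L)                                   ≡⟨ inv-agree ν (≈⇒AgreeOnRows (upperPart-loop≈cascade 1 m W)) ⟩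
      inv ν (cascade m (upperPart 1 W))                       ≡⟨ inv-cascade m (upperPart 1 W) ⟩
      inv ν (upperPart 1 W) ℤ.+ sgn (R 2 1) (R 2 2)           ≡⟨ cong (ℤ._+ sgn (R 2 1) (R 2 2)) (inv-agree ν (upperPart-swapRow-below R)) ⟩
      I ℤ.+ sgn (R 2 1) (R 2 2)                               ∎
    shuffle : ∀ I x y p q s t → I ℤ.+ (p ℤ.- q ℤ.+ (s ℤ.- t)) ℤ.+ (x ℤ.+ (q ℤ.- p)) ≡ I ℤ.+ (y ℤ.+ (s ℤ.- t)) ℤ.+ (x ℤ.- y)
    shuffle = ℤ-Ring.solve-∀

  tau-below : ∀ k l T {i} j → i ≤ k → tau k l T i j ≡ T i j
  tau-below k l T j i≤k with xAx (T (suc k) 1) (T (suc k) 2) (T k 1)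
  ... | true = trans (tauLoop-below (l ∸ 1) (swapRow T (suc k)) (suc k) j (m≤n⇒m≤1+n i≤k)) (swapRow-other T j (<⇒≢ (s≤s i≤k)))
  ... | false = refl

  maj-upperPart-tau : ∀ k n T →
    maj (replicate (suc n) 2) (upperPart k (tau k (suc n) T)) ≡ maj (replicate (suc n) 2) (upperPart k T)
  maj-upperPart-tau k n T with xAx (T (suc k) 1) (T (suc k) 2) (T k 1)
  ... | true = trans (maj-agree (replicate (suc n) 2) (≈⇒AgreeOnRows (upperPart-loop≈cascade k n T))) (maj-cascade n (upperPart k T))
  ... | false = refl

  xAx-upperPart : ∀ k T → xAx (T (suc k) 1) (T (suc k) 2) (T k 1) ≡ xAx (upperPart k T 1 1) (upperPart k T 1 2) (T k 1)
  xAx-upperPart k T = cong (λ r → xAx (T r 1) (T r 2) (T k 1)) (+-comm 1 k)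

  inv-upperPart-tau : ∀ k n T →
    inv (replicate (suc n) 2) (upperPart k (tau k (suc n) T)) ℤ.+
      window (tau k (suc n) T (k + 1) 1) (tau k (suc n) T (k + 1) 2) (tau k (suc n) T k 1) ≡
    inv (replicate (suc n) 2) (upperPart k T)
  inv-upperPart-tau k n T with xAx (T (suc k) 1) (T (suc k) 2) (T k 1) in separated
  ... | false = trans (cong (λ w → inv ν R ℤ.+ w) (window-¬xAx (R 1 1) (R 1 2) (T k 1) (trans (sym (xAx-upperPart k T)) separated)))
                      (ℤ.+-identityʳ (inv ν R))
    where
    ν = replicate (suc n) 2
    R = upperPart k T
  ... | true = begin
    inv ν (upperPart k L) ℤ.+ window (L (k + 1) 1) (L (k + 1) 2) (L k 1)
        ≡⟨ cong₂ ℤ._+_ (inv-agree ν (≈⇒AgreeOnRows (upperPart-loop≈cascade k n T))) seam ⟩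
    inv ν (cascade n R) ℤ.+ window (R 1 2) (R 1 1) A
        ≡⟨ cong (ℤ._+ window (R 1 2) (R 1 1) A) (inv-cascade n R) ⟩
    inv ν R ℤ.+ sgn (R 1 1) (R 1 2) ℤ.+ window (R 1 2) (R 1 1) A
        ≡⟨ cong (λ s → inv ν R ℤ.+ s ℤ.+ window (R 1 2) (R 1 1) A) (window-xAx (R 1 1) (R 1 2) A (trans (sym (xAx-upperPart k T)) separated)) ⟨
    inv ν R ℤ.+ window (R 1 1) (R 1 2) A ℤ.+ window (R 1 2) (R 1 1) A
        ≡⟨ cancel (inv ν R) (+ 𝟙 (A <ᵇ R 1 2)) (+ 𝟙 (A <ᵇ R 1 1)) ⟩
    inv ν R ∎
    where
    ν = replicate (suc n) 2
    R = upperPart k T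
    A = T k 1
    L = tauLoop n (swapRow T (suc k)) (suc k)
    bottom-row : ∀ j → L (k + 1) j ≡ swapRow R 1 1 j
    bottom-row j = trans (upperPart-loop≈cascade k n T 1 j) (tauLoop-below n (swapRow R 1) 1 j ≤-refl)
    below : L k 1 ≡ A
    below = trans (tauLoop-below n (swapRow T (suc k)) (suc k) 1 (n≤1+n k)) (swapRow-other T 1 (<⇒≢ (n<1+n k)))
    seam : window (L (k + 1) 1) (L (k + 1) 2) (L k 1) ≡ window (R 1 2) (R 1 1) A
    seam = trans (cong₂ (λ a b → window a b (L k 1)) (bottom-row 1) (bottom-row 2)) (cong (window (R 1 2) (R 1 1)) below)
    cancel : ∀ I x y → I ℤ.+ (x ℤ.- y) ℤ.+ (y ℤ.- x) ≡ I
    cancel = ℤ-Ring.solve-∀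

  module _ (μ : List ℕ) (n : ℕ) (1≤k : 1 ≤ length μ) (T : Filling) where
    open Stack μ n 1≤k
    private
      k = length μ
      ν = replicate (suc n) 2
      τ = tau k (suc n) T
      τ≐T : AgreeOnRows k τ T
      τ≐T i j _ = tau-below k (suc n) T j

    maj-tau : maj (μ ++ ν) τ ≡ maj μ T + suc n * descentsUnderRectangle τ + maj ν (upperPart k T)
    maj-tau = trans (maj-stack τ) (cong₂ (λ a b → a + suc n * descentsUnderRectangle τ + b) (maj-agree μ τ≐T) (maj-upperPart-tau k n T))

    inv-tau : 1 ≤ rowLen μ k → inv (μ ++ ν) τ ≡ inv μ T ℤ.+ inv ν (upperPart k T)
    inv-tau 1≤r = begin
      inv (μ ++ ν) τ                                                          ≡⟨ inv-stack τ 1≤r ⟩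
      inv μ τ ℤ.+ inv ν (upperPart k τ) ℤ.+ window (τ (k + 1) 1) (τ (k + 1) 2) (τ k 1)
                                                                              ≡⟨ ℤ.+-assoc (inv μ τ) _ _ ⟩
      inv μ τ ℤ.+ (inv ν (upperPart k τ) ℤ.+ window (τ (k + 1) 1) (τ (k + 1) 2) (τ k 1))
                                                                              ≡⟨ cong₂ ℤ._+_ (inv-agree μ τ≐T) (inv-upperPart-tau k n T) ⟩
      inv μ T ℤ.+ inv ν (upperPart k T)                                       ∎

  +[a+x+b]-[a+b]≡x : ∀ a x b → + (a + x + b) ℤ.- (+ a ℤ.+ + b) ≡ + x
  +[a+x+b]-[a+b]≡x a x b = begin
    + (a + x + b) ℤ.- (+ a ℤ.+ + b)            ≡⟨ cong (ℤ._- (+ a ℤ.+ + b)) (trans (ℤ.pos-+ (a + x) b) (cong (ℤ._+ + b) (ℤ.pos-+ a x))) ⟩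
    + a ℤ.+ + x ℤ.+ + b ℤ.- (+ a ℤ.+ + b)      ≡⟨ cancel (+ a) (+ x) (+ b) ⟩
    + x                                        ∎
    where
    cancel : ∀ a x b → a ℤ.+ x ℤ.+ b ℤ.- (a ℤ.+ b) ≡ x
    cancel = ℤ-Ring.solve-∀

open FillingStatistics
open import Data.Nat using (ℕ; _≤_; suc; _*_; s≤s; z≤n)
open import Data.Nat.Divisibility using (m∣m*n)
open import Data.Nat.Properties using (≤-trans)
open import Data.List using (List; length; replicate; _++_)
open import Data.Product using (_×_; _,_)
open import Data.Integer using (+_; _-_; _+_)
open import Data.Integer.Divisibility using (_∣_)
open import Relation.Binary.PropositionalEquality using (_≡_; refl; sym; trans; cong; subst)

theorem4 : (k l : ℕ) → 1 ≤ k → 1 ≤ l →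
    (μ' : List ℕ) → IsPartition μ' → length μ' ≡ k → 2 ≤ rowLen μ' k →
    (T : Filling) → IsFilling (μ' ++ replicate l 2) T →
      ((+ l) ∣ (+ maj (μ' ++ replicate l 2) (tau k l T)
                  - (+ maj μ' T + + maj (replicate l 2) (upperPart k T))))
      × (inv (μ' ++ replicate l 2) (tau k l T)
           ≡ inv μ' T + inv (replicate l 2) (upperPart k T))
-- The partition condition and the positivity of the entries are not needed.
theorem4 .(length μ') (suc n) 1≤k _ μ' _ refl 2≤r T _ =
  subst (+ suc n ∣_) (sym maj-difference) (m∣m*n _) , inv-tau μ' n 1≤k T (≤-trans (s≤s z≤n) 2≤r)
  where
  open Stack μ' n 1≤k using (descentsUnderRectangle)
  τ = tau (length μ') (suc n) T
  R = upperPart (length μ') T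
  maj-difference : + maj (μ' ++ replicate (suc n) 2) τ - (+ maj μ' T + + maj (replicate (suc n) 2) R) ≡
                   + (suc n * descentsUnderRectangle τ)
  maj-difference = trans (cong (λ m → + m - (+ maj μ' T + + maj (replicate (suc n) 2) R)) (maj-tau μ' n 1≤k T))
                         (+[a+x+b]-[a+b]≡x (maj μ' T) _ (maj (replicate (suc n) 2) R))
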